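{- Let $d\ge1$. If a finite family $\mathcal{F}\subseteq \binom{\mathbb{N}}{d}$ is shifted, then $\mathrm{Inc}(\mathcal{F})$ is also shifted.
   Context: $\mathbb{N}=\{1,2,\dots\}$; $\binom{\mathbb{N}}{d}$ is the set of $d$-subsets of $\mathbb{N}$, each written $\mathbf{u}=(u_1,\dots,u_d)$ with $u_1<\dots<u_d$. Borel order: $\mathbf{v}\le_B\mathbf{u}$ if $v_i\le u_i$ for all $i$. A family $\mathcal{F}$ is shifted if $\mathbf{v}\in\mathcal{F}$ whenever $\mathbf{v}\le_B\mathbf{u}$ for some $\mathbf{u}\in\mathcal{F}$. $\mathrm{Inc}_1$ is the set of maps $\pi:\mathbb{N}\to\mathbb{N}$ with $\pi(j)<\pi(j+1)$ and $\pi(j)\le j+1$ for all $j$, acting by $\pi(\mathbf{u})=(\pi(u_1),\dots,\pi(u_d))$; $\mathrm{Inc}(\mathcal{F})=\{\pi(\mathbf{u})\mid\mathbf{u}\in\mathcal{F},\pi\in\mathrm{Inc}_1\}$. -}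

module Defs where

open import Data.Nat using (ℕ; suc; _≤_; _<_)
open import Data.Fin using (Fin) renaming (_<_ to _<ᶠ_)
open import Data.Vec using (Vec; lookup; map)
open import Data.List using (List)
open import Data.List.Membership.Propositional using (_∈_)
open import Data.Product using (_×_; ∃; ∃-syntax)
open import Relation.Binary.PropositionalEquality using (_≡_)

-- A d-subset of ℕ = {1,2,...}, written increasingly (u₁ < ... < u_d),
-- represented as a vector of length d with positive, strictly increasing entries.
IsDSubset : {d : ℕ} → Vec ℕ d → Set
IsDSubset {d} u =
  (∀ (i : Fin d) → 1 ≤ lookup u i) ×
  (∀ (i j : Fin d) → i <ᶠ j → lookup u i < lookup u j)

_≤B_ : {d : ℕ} → Vec ℕ d → Vec ℕ d → Set
_≤B_ {d} v u = ∀ (i : Fin d) → lookup v i ≤ lookup u i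

Shifted : {d : ℕ} → (Vec ℕ d → Set) → Set
Shifted {d} P = ∀ (u v : Vec ℕ d) → P u → IsDSubset v → v ≤B u → P v

-- Inc₁: maps π : ℕ → ℕ (on the domain {1,2,...}; the value at 0 is
-- irrelevant) with values in {1,2,...}, π(j) < π(j+1) and π(j) ≤ j+1 for all j ≥ 1.
Inc₁ : (ℕ → ℕ) → Set
Inc₁ π = (1 ≤ π 1) × (∀ (j : ℕ) → 1 ≤ j → (π j < π (suc j)) × (π j ≤ suc j))

IncFam : {d : ℕ} → List (Vec ℕ d) → Vec ℕ d → Set
IncFam F w = ∃[ u ] ∃[ π ] ((u ∈ F) × Inc₁ π × (w ≡ map π u))

module Submission where

-- Let F be a finite shifted family of d-subsets, u ∈ F, π ∈ Inc₁, and let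
-- v be a d-subset with v ≤_B π(u).  We exhibit v itself as an element of Inc(F).
--
-- Let t be the least positive integer missing from v.  Then v consists of an
-- initial run 1, 2, ..., t-1 followed by entries larger than t.  The map
-- "collapse t" (x ↦ x for x ≤ t, x ↦ x-1 for x > t) sends v to a d-subset v'
-- with v = skip t (v'), where "skip t" (y ↦ y for y < t, y ↦ y+1 otherwise)
-- belongs to Inc₁.  Moreover v' ≤_B u: the run entries satisfy v_i = i ≤ u_i
-- because u is increasing, and the others satisfy v_i - 1 ≤ π(u_i) - 1 ≤ u_i.
-- Since F is shifted, v' ∈ F, hence v = skip t (v') ∈ Inc(F).

open import Defs
open import Data.Nat using (ℕ; suc; pred; _+_; _≤_; _<_; z≤n; s≤s; _≟_; _≤?_; _<?_; >-nonZero)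
open import Data.Nat.Properties
open import Data.Fin using (Fin; toℕ) renaming (zero to fzero; suc to fsuc; _<_ to _<ᶠ_)
open import Data.Vec using (Vec; []; _∷_; lookup; map)
open import Data.Vec.Properties using (lookup-map; tabulate∘lookup; tabulate-cong)
open import Data.List using (List)
open import Data.List.Relation.Unary.All using (All)
import Data.List.Relation.Unary.All as All
open import Data.List.Membership.Propositional using (_∈_)
open import Data.Product using (_×_; _,_; proj₁; proj₂)
open import Data.Sum using (_⊎_; inj₁; inj₂)
open import Relation.Nullary using (yes; no)
open import Relation.Nullary.Negation using (contradiction)
open import Relation.Binary.PropositionalEquality
open import Relation.Binary.Definitions using (tri<; tri≈; tri>)

Increasing : {n : ℕ} → Vec ℕ n → Set
Increasing v = ∀ i j → i <ᶠ j → lookup v i < lookup v j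

increasing-tail : ∀ {n} x (xs : Vec ℕ n) → Increasing (x ∷ xs) → Increasing xs
increasing-tail x xs inc i j i<j = inc (fsuc i) (fsuc j) (s≤s i<j)

head<tail : ∀ {n} x (xs : Vec ℕ n) → Increasing (x ∷ xs) → ∀ i → x < lookup xs i
head<tail x xs inc i = inc fzero (fsuc i) (s≤s z≤n)

increasing-lowerBound : ∀ {n} s (v : Vec ℕ n) → Increasing v →
  (∀ i → s ≤ lookup v i) → ∀ i → s + toℕ i ≤ lookup v i
increasing-lowerBound s (x ∷ xs) inc lo fzero = subst (_≤ x) (sym (+-identityʳ s)) (lo fzero)
increasing-lowerBound s (x ∷ xs) inc lo (fsuc i) =
  subst (_≤ lookup xs i) (sym (+-suc s (toℕ i)))
    (increasing-lowerBound (suc s) xs (increasing-tail x xs inc)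
      (λ k → <-≤-trans (s≤s (lo fzero)) (head<tail x xs inc k)) i)

firstGap : ∀ {n} → ℕ → Vec ℕ n → ℕ
firstGap s [] = s
firstGap s (x ∷ xs) with x ≟ s
... | yes _ = firstGap (suc s) xs
... | no _  = s

firstGap-≥ : ∀ {n} s (v : Vec ℕ n) → s ≤ firstGap s v
firstGap-≥ s [] = ≤-refl
firstGap-≥ s (x ∷ xs) with x ≟ s
... | yes _ = ≤-trans (n≤1+n s) (firstGap-≥ (suc s) xs)
... | no _  = ≤-refl

Gap : {n : ℕ} → ℕ → ℕ → Vec ℕ n → Set
Gap s t v = ∀ i → (lookup v i < t × lookup v i ≡ s + toℕ i) ⊎ t < lookup v i

firstGap-isGap : ∀ {n} s (v : Vec ℕ n) → Increasing v → (∀ i → s ≤ lookup v i) →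
  Gap s (firstGap s v) v
firstGap-isGap s (x ∷ xs) inc lo i with x ≟ s
firstGap-isGap s (x ∷ xs) inc lo fzero | yes x≡s =
  inj₁ (subst (_< firstGap (suc s) xs) (sym x≡s) (firstGap-≥ (suc s) xs)
       , trans x≡s (sym (+-identityʳ s)))
firstGap-isGap s (x ∷ xs) inc lo (fsuc i) | yes x≡s
  with firstGap-isGap (suc s) xs (increasing-tail x xs inc)
         (λ k → subst (λ z → suc z ≤ lookup xs k) x≡s (head<tail x xs inc k)) i
... | inj₁ (below , run) = inj₁ (below , trans run (sym (+-suc s (toℕ i))))
... | inj₂ above = inj₂ above
firstGap-isGap s (x ∷ xs) inc lo i | no x≢s = inj₂ (<-≤-trans s<x (x≤ i))
  where
  s<x : s < x
  s<x = ≤∧≢⇒< (lo fzero) (λ s≡x → x≢s (sym s≡x))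
  x≤ : ∀ k → x ≤ lookup (x ∷ xs) k
  x≤ fzero    = ≤-refl
  x≤ (fsuc k) = <⇒≤ (head<tail x xs inc k)

gap-avoids : ∀ {n s t} (v : Vec ℕ n) → Gap s t v → ∀ i → lookup v i ≢ t
gap-avoids v gap i vᵢ≡t with gap i
... | inj₁ (below , _) = <-irrefl vᵢ≡t below
... | inj₂ above       = <-irrefl (sym vᵢ≡t) above

skip : ℕ → ℕ → ℕ
skip t y with y <? t
... | yes _ = y
... | no _  = suc y

skip-< : ∀ {t y} → y < t → skip t y ≡ y
skip-< {t} {y} y<t with y <? t
... | yes _  = refl
... | no y≮t = contradiction y<t y≮t

skip-≥ : ∀ {t y} → t ≤ y → skip t y ≡ suc y
skip-≥ {t} {y} t≤y with y <? t
... | yes y<t = contradiction t≤y (<⇒≱ y<t)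
... | no _    = refl

skip-between : ∀ t y → y ≤ skip t y × skip t y ≤ suc y
skip-between t y with y <? t
... | yes _ = ≤-refl , n≤1+n y
... | no _  = n≤1+n y , ≤-refl

skip-strict : ∀ t y → skip t y < skip t (suc y)
skip-strict t y with y <? t
... | yes _  = proj₁ (skip-between t (suc y))
... | no y≮t = ≤-reflexive (sym (skip-≥ (≤-trans (≮⇒≥ y≮t) (n≤1+n y))))

skip-Inc₁ : ∀ t → Inc₁ (skip t)
skip-Inc₁ t = proj₁ (skip-between t 1)
            , λ j _ → skip-strict t j , proj₂ (skip-between t j)

collapse : ℕ → ℕ → ℕ
collapse t x with x ≤? t
... | yes _ = x
... | no _  = pred x

collapse-≤ : ∀ {t x} → x ≤ t → collapse t x ≡ x
collapse-≤ {t} {x} x≤t with x ≤? t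
... | yes _  = refl
... | no x≰t = contradiction x≤t x≰t

collapse-> : ∀ {t x} → t < x → collapse t x ≡ pred x
collapse-> {t} {x} t<x with x ≤? t
... | yes x≤t = contradiction x≤t (<⇒≱ t<x)
... | no _    = refl

skip-collapse : ∀ {t x} → x ≢ t → skip t (collapse t x) ≡ x
skip-collapse {t} {x} x≢t with <-cmp x t
... | tri< x<t _ _ = trans (cong (skip t) (collapse-≤ (<⇒≤ x<t))) (skip-< x<t)
... | tri≈ _ x≡t _ = contradiction x≡t x≢t
... | tri> _ _ t<x@(s≤s t≤x-1) = trans (cong (skip t) (collapse-> t<x)) (skip-≥ t≤x-1)

collapse-strict : ∀ {t x y} → x ≢ t → x < y → collapse t x < collapse t y
collapse-strict {t} {x} {y} x≢t x<y with <-cmp x t | ≤-<-connex y t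
... | tri< x<t _ _ | inj₁ y≤t =
  subst₂ _<_ (sym (collapse-≤ (<⇒≤ x<t))) (sym (collapse-≤ y≤t)) x<y
... | tri< x<t _ _ | inj₂ t<y =
  subst₂ _<_ (sym (collapse-≤ (<⇒≤ x<t))) (sym (collapse-> t<y)) (<-≤-trans x<t (<⇒≤pred t<y))
... | tri≈ _ x≡t _ | _ = contradiction x≡t x≢t
... | tri> _ _ t<x | _ =
  subst₂ _<_ (sym (collapse-> t<x)) (sym (collapse-> (<-trans t<x x<y)))
    (pred-mono-< {{>-nonZero (≤-<-trans z≤n t<x)}} x<y)

collapse-positive : ∀ {t x} → 1 ≤ t → 1 ≤ x → 1 ≤ collapse t x
collapse-positive {t} {x} 1≤t 1≤x with x ≤? t
... | yes _  = 1≤x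
... | no x≰t = <⇒≤pred (≤-<-trans 1≤t (≰⇒> x≰t))

vec-ext : ∀ {n} {xs ys : Vec ℕ n} → (∀ i → lookup xs i ≡ lookup ys i) → xs ≡ ys
vec-ext {xs = xs} {ys} same =
  trans (sym (tabulate∘lookup xs)) (trans (tabulate-cong same) (tabulate∘lookup ys))

skip∘collapse : ∀ {n t} (v : Vec ℕ n) → (∀ i → lookup v i ≢ t) →
  map (skip t) (map (collapse t) v) ≡ v
skip∘collapse {t = t} v avoids = vec-ext λ i → begin
  lookup (map (skip t) (map (collapse t) v)) i ≡⟨ lookup-map i (skip t) (map (collapse t) v) ⟩
  skip t (lookup (map (collapse t) v) i)       ≡⟨ cong (skip t) (lookup-map i (collapse t) v) ⟩
  skip t (collapse t (lookup v i))             ≡⟨ skip-collapse (avoids i) ⟩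
  lookup v i                                   ∎
  where open ≡-Reasoning

collapse-isDSubset : ∀ {n t} (v : Vec ℕ n) → 1 ≤ t → (∀ i → lookup v i ≢ t) →
  IsDSubset v → IsDSubset (map (collapse t) v)
collapse-isDSubset {t = t} v 1≤t avoids (pos , inc) =
    (λ i → subst (1 ≤_) (sym (lookup-map i (collapse t) v)) (collapse-positive 1≤t (pos i)))
  , (λ i j i<j → subst₂ _<_ (sym (lookup-map i (collapse t) v)) (sym (lookup-map j (collapse t) v))
                   (collapse-strict (avoids i) (inc i j i<j)))

collapse-≤B : ∀ {n t} {π : ℕ → ℕ} (u v : Vec ℕ n) → IsDSubset u → Inc₁ π →
  Gap 1 t v → v ≤B map π u → map (collapse t) v ≤B u
collapse-≤B {t = t} {π} u v (pos , inc) incπ gap v≤πu i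
  rewrite lookup-map i (collapse t) v with gap i
... | inj₁ (below , run) =
  subst (_≤ lookup u i) (sym (trans (collapse-≤ (<⇒≤ below)) run))
    (increasing-lowerBound 1 u inc pos i)
... | inj₂ above = subst (_≤ lookup u i) (sym (collapse-> above)) (pred-mono-≤ v≤suc-u)
  where
  v≤suc-u : lookup v i ≤ suc (lookup u i)
  v≤suc-u = ≤-trans (v≤πu i)
    (subst (_≤ suc (lookup u i)) (sym (lookup-map i π u)) (proj₂ (proj₂ incπ (lookup u i) (pos i))))

corollary3p4 : (d : ℕ) → 1 ≤ d → (F : List (Vec ℕ d)) → All IsDSubset F →
    Shifted (λ u → u ∈ F) → Shifted (IncFam F)
corollary3p4 d _ F allF shF _ v (u , π , u∈F , incπ , refl) v-sub v≤πu =
  map (collapse t) v , skip t , collapsed∈F , skip-Inc₁ t , sym (skip∘collapse v avoids)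
  where
  t = firstGap 1 v
  gap : Gap 1 t v
  gap = firstGap-isGap 1 v (proj₂ v-sub) (proj₁ v-sub)
  avoids : ∀ i → lookup v i ≢ t
  avoids = gap-avoids v gap
  collapsed∈F : map (collapse t) v ∈ F
  collapsed∈F = shF u (map (collapse t) v) u∈F
    (collapse-isDSubset v (firstGap-≥ 1 v) avoids v-sub)
    (collapse-≤B u v (All.lookup allF u∈F) incπ gap v≤πu)
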